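{- Let $P$ be a partition of $T$. If a vertex $v$ of $T$ with $v\notin P_i$ has a nonempty, connected $i$-neighborhood, then $P_i\cup\{v\}$ is simply connected.
   Context: $G_\Delta$ is the infinite triangular lattice; $T$ is an equilateral triangular subgraph. A set of vertices is simply connected if it induces a connected subgraph and no cycle of $G_\Delta$ made of its vertices encloses in the plane a vertex not in the set. A partition of $T$ is a partition of $V(T)$ into three labelled simply connected districts $P_1,P_2,P_3$. The $i$-neighborhood of $v$ is the set of neighbours of $v$ in $T$ lying in $P_i$; it is connected if it induces a connected subgraph. -}

module Defs where

open import Data.Nat using (ℕ; _≤_)
open import Data.Integer as ℤ using (ℤ; _+_; _-_; 0ℤ; 1ℤ; -1ℤ; +_)
open import Data.Fin using (Fin)
open import Data.Bool using (Bool; true; false; _∧_; _∨_; _xor_)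
open import Data.Product using (_×_; _,_; proj₁; proj₂; ∃)
open import Data.List using (List; []; _∷_; _++_; [_]; zip; foldr; length)
open import Data.List.Membership.Propositional using (_∈_)
open import Data.List.Relation.Unary.All using (All)
open import Data.List.Relation.Unary.Linked using (Linked)
open import Data.List.Relation.Unary.Unique.Propositional using (Unique)
open import Relation.Binary.PropositionalEquality using (_≡_)
open import Relation.Nullary using (¬_)
open import Relation.Nullary.Decidable using (⌊_⌋)

-- Vertices are ℤ × ℤ ("axial" coordinates); the vertex (a , b) is drawn
-- in the plane at  a·(1,0) + b·(1/2, √3/2).

V : Set
V = ℤ × ℤ

directions : List V
directions = (1ℤ , 0ℤ) ∷ (-1ℤ , 0ℤ) ∷ (0ℤ , 1ℤ) ∷ (0ℤ , -1ℤ)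
           ∷ (1ℤ , -1ℤ) ∷ (-1ℤ , 1ℤ) ∷ []

Adj : V → V → Set
Adj (a , b) (c , d) = (c - a , d - b) ∈ directions

-- Equilateral triangular subgraphs T of G_Δ (sides along lattice lines).

record Triangle : Set where
  constructor triangle
  field
    corner : V
    side   : ℕ
    up     : Bool

open Triangle public

InT : Triangle → V → Set
InT (triangle (a₀ , b₀) n true)  (a , b) =
  ℤ._≤_ a₀ a × ℤ._≤_ b₀ b × ℤ._≤_ ((a - a₀) + (b - b₀)) (+ n)
InT (triangle (a₀ , b₀) n false) (a , b) =
  ℤ._≤_ a a₀ × ℤ._≤_ b b₀ × ℤ._≤_ ((a₀ - a) + (b₀ - b)) (+ n)

VSet : Set₁
VSet = V → Set

data Path (S : VSet) : V → V → Set where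
  here : ∀ {u} → S u → Path S u u
  step : ∀ {u w v} → S u → Adj u w → Path S w v → Path S u v

Connected : VSet → Set
Connected S = ∀ {u v} → S u → S v → Path S u v

IsCycle : List V → Set
IsCycle []       = Data.Empty.⊥ where import Data.Empty
IsCycle (x ∷ xs) =
  2 ≤ length xs × Unique (x ∷ xs) × Linked Adj (x ∷ xs ++ [ x ])

cycleEdges : List V → List (V × V)
cycleEdges []       = []
cycleEdges (x ∷ xs) = zip (x ∷ xs) (xs ++ [ x ])

-- Point-in-polygon (ray casting) in the plane: cast from w the ray in
-- direction (1,0) shifted infinitesimally upwards.  An edge of the lattice
-- meets it iff it joins row b_w to row b_w + 1 and its endpoint on row b_w
-- lies strictly to the right of w.
crosses : V → V × V → Bool
crosses (wa , wb) ((pa , pb) , (qa , qb)) =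
     (⌊ pb ℤ.≟ wb ⌋ ∧ ⌊ qb ℤ.≟ (wb + 1ℤ) ⌋ ∧ ⌊ wa ℤ.<? pa ⌋)
  ∨  (⌊ qb ℤ.≟ wb ⌋ ∧ ⌊ pb ℤ.≟ (wb + 1ℤ) ⌋ ∧ ⌊ wa ℤ.<? qa ⌋)

-- the closed polygon C encloses the point w (w not a vertex of C):
-- odd number of crossings.
Encloses : List V → V → Set
Encloses C w = foldr (λ e acc → crosses w e xor acc) false (cycleEdges C) ≡ true

SimplyConnected : VSet → Set
SimplyConnected S =
  Connected S ×
  (∀ (C : List V) → IsCycle C → All S C →
     ∀ (w : V) → ¬ S w → ¬ Encloses C w)

-- Partitions of T into three labelled simply connected districts.
-- A labelling assigns a district to every vertex (values off T are
-- irrelevant); district i is  P_i = { u ∈ T | lab u ≡ i }.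

District : Triangle → (V → Fin 3) → Fin 3 → VSet
District T lab i u = InT T u × lab u ≡ i

IsPartition : Triangle → (V → Fin 3) → Set
IsPartition T lab =
  ∀ (i : Fin 3) → ∃ (District T lab i) × SimplyConnected (District T lab i)

Nbhd : Triangle → (V → Fin 3) → Fin 3 → V → VSet
Nbhd T lab i v u = Adj v u × District T lab i u

AddVertex : VSet → V → VSet
AddVertex S v u = S u Data.Sum.⊎ u ≡ v where import Data.Sum

-- Only the absence of holes needs an argument.  Suppose a cycle C of
-- P_i ∪ {v} had an odd number of crossings with the ray cast from some
-- w ∉ P_i ∪ {v}.  Every passage a → v → b of C through v has a and b in
-- the i-neighbourhood of v, which is connected, so it can be rerouted along
-- a path from a to b inside that neighbourhood.  Consecutive vertices of
-- the path span a unit triangle with v, and the ray from a point that is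
-- not a corner of a unit triangle crosses its boundary an even number of
-- times; hence rerouting preserves the parity of crossings.  This leaves a
-- closed walk in P_i of odd parity, and cutting it at repeated vertices
-- yields a cycle of P_i of odd parity, i.e. one enclosing w: impossible,
-- since P_i is simply connected.
module Submission where

open import Defs
open import Data.Bool using (Bool; true; false; _∧_; _∨_; _xor_)
open import Data.Bool.Properties using (∨-identityʳ; ∨-comm; xor-identityʳ; xor-same; xor-comm; xor-assoc)
open import Data.Empty using (⊥-elim)
open import Data.Fin using (Fin; zero; suc)
import Data.Fin.Properties as Fin
open import Data.Integer as ℤ using (_+_; _-_; 0ℤ; 1ℤ; -1ℤ)
import Data.Integer.Properties as ℤ
open import Data.Integer.Tactic.RingSolver using (solve-∀)
open import Data.List using (List; []; _∷_; _++_; [_]; zip; foldr; length; lookup)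
open import Data.List.Properties using (++-assoc)
open import Data.List.Membership.Propositional using (_∈_)
open import Data.List.Membership.Propositional.Properties using (∈-∃++)
import Data.List.Membership.DecPropositional as DecMembership
open import Data.List.Relation.Binary.Subset.Propositional using (_⊆_)
open import Data.List.Relation.Binary.Subset.Propositional.Properties
  using (⊆-refl; ⊆-trans; xs⊆xs++ys; xs⊆ys++xs; ++⁺ʳ)
open import Data.List.Relation.Unary.All as All using (All; []; _∷_)
import Data.List.Relation.Unary.All.Properties as All
open import Data.List.Relation.Unary.AllPairs using (_∷_)
open import Data.List.Relation.Unary.Any using (index)
open import Data.List.Relation.Unary.Any.Properties using (lookup-index)
open import Data.List.Relation.Unary.Linked using (Linked; [-]; _∷_)
open import Data.List.Relation.Unary.Unique.Propositional using (Unique; [])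
open import Data.Nat as ℕ using (s≤s; z≤n)
open import Data.Nat.Induction using (<-wellFounded)
import Data.Nat.Properties as ℕ
open import Data.Product using (Σ; _×_; _,_; proj₁; proj₂; ∃; ∃-syntax; map₁; map₂)
open import Data.Product.Properties using (≡-dec)
open import Data.Sum using (_⊎_; inj₁; inj₂)
open import Function.Base using (_∘_)
open import Function.Bundles using (_⇔_; mk⇔)
open import Induction.WellFounded using (Acc; acc)
open import Relation.Binary.PropositionalEquality hiding ([_])
open import Relation.Nullary using (¬_; Dec; yes; no)
open import Relation.Nullary.Decidable
  using (⌊_⌋; isYes≗does; dec-true; does-⇔; from-yes; from-no; _→-dec_; _⊎-dec_)

infixl 6 _⊕_ _⊖_

_⊕_ _⊖_ : V → V → V
(a , b) ⊕ (c , d) = (a + c , b + d)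
(a , b) ⊖ (c , d) = (a - c , b - d)

origin : V
origin = (0ℤ , 0ℤ)

⊕-identityˡ : ∀ p → origin ⊕ p ≡ p
⊕-identityˡ (a , b) = cong₂ _,_ (ℤ.+-identityˡ a) (ℤ.+-identityˡ b)

⊖-⊕ : ∀ p q → p ⊖ q ⊕ q ≡ p
⊖-⊕ (a , b) (c , d) = cong₂ _,_ (identity a c) (identity b d)
  where identity : ∀ i j → i - j + j ≡ i
        identity = solve-∀

⊖⇒⊕ : ∀ {p q d} → p ⊖ q ≡ d → p ≡ d ⊕ q
⊖⇒⊕ {p} {q} p⊖q≡d = trans (sym (⊖-⊕ p q)) (cong (_⊕ q) p⊖q≡d)

⊕-⊖-⊕ : ∀ p q r → p ⊕ r ⊖ (q ⊕ r) ≡ p ⊖ q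
⊕-⊖-⊕ (a , b) (c , d) (e , f) = cong₂ _,_ (identity a c e) (identity b d f)
  where identity : ∀ i j k → i + k - (j + k) ≡ i - j
        identity = solve-∀

⊖-anticomm : ∀ p q → p ⊖ q ≡ origin ⊖ (q ⊖ p)
⊖-anticomm (a , b) (c , d) = cong₂ _,_ (identity a c) (identity b d)
  where identity : ∀ i j → i - j ≡ 0ℤ - (j - i)
        identity = solve-∀

⊖-self : ∀ p → p ⊖ p ≡ origin
⊖-self (a , b) = cong₂ _,_ (ℤ.+-inverseʳ a) (ℤ.+-inverseʳ b)

_≟_ : (p q : V) → Dec (p ≡ q)
_≟_ = ≡-dec ℤ._≟_ ℤ._≟_

open DecMembership _≟_ using (_∈?_)
open import Data.List.Relation.Unary.Unique.DecPropositional _≟_ using (unique?)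

Adj? : ∀ p q → Dec (Adj p q)
Adj? p q = q ⊖ p ∈? directions

directions-neg : ∀ {d} → d ∈ directions → origin ⊖ d ∈ directions
directions-neg = All.lookup (from-yes (All.all? (λ d → origin ⊖ d ∈? directions) directions))

Adj-sym : ∀ {p q} → Adj p q → Adj q p
Adj-sym {p} {q} p~q = subst (_∈ directions) (sym (⊖-anticomm p q)) (directions-neg p~q)

Adj-irrefl : ∀ {p} → ¬ Adj p p
Adj-irrefl {p} p~p = from-no (origin ∈? directions) (subst (_∈ directions) (⊖-self p) p~p)

Adj-translate : ∀ {p q} r → Adj (p ⊕ r) (q ⊕ r) → Adj p q
Adj-translate {p} {q} r = subst (_∈ directions) (⊕-⊖-⊕ q p r)

offset : Fin 6 → V
offset = lookup directions

Adj⇒offset : ∀ {p q} → Adj p q → ∃[ k ] q ≡ offset k ⊕ p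
Adj⇒offset p~q = index p~q , ⊖⇒⊕ (lookup-index p~q)

-- offset (next k) is offset k turned through 60° counterclockwise.
next : Fin 6 → Fin 6
next zero                                = suc (suc zero)
next (suc zero)                          = suc (suc (suc zero))
next (suc (suc zero))                    = suc (suc (suc (suc (suc zero))))
next (suc (suc (suc zero)))              = suc (suc (suc (suc zero)))
next (suc (suc (suc (suc zero))))        = zero
next (suc (suc (suc (suc (suc zero))))) = suc zero

offsets-adjacent : ∀ k l → Adj (offset k) (offset l) → l ≡ next k ⊎ k ≡ next l
offsets-adjacent = from-yes (Fin.all? λ k → Fin.all? λ l →
  Adj? (offset k) (offset l) →-dec (l Fin.≟ next k ⊎-dec k Fin.≟ next l))

⌊⌋-true : ∀ {A : Set} (a? : Dec A) → A → ⌊ a? ⌋ ≡ true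
⌊⌋-true a? a = trans (isYes≗does a?) (dec-true a? a)

⌊⌋-⇔ : ∀ {A B : Set} → A ⇔ B → (a? : Dec A) (b? : Dec B) → ⌊ a? ⌋ ≡ ⌊ b? ⌋
⌊⌋-⇔ A⇔B a? b? = trans (isYes≗does a?) (trans (does-⇔ A⇔B a? b?) (sym (isYes≗does b?)))

∧-disjoint : ∀ {A B : Set} (a? : Dec A) (b? : Dec B) → (A → ¬ B) → ∀ c → ⌊ a? ⌋ ∧ ⌊ b? ⌋ ∧ c ≡ false
∧-disjoint (yes a) (yes b) a⇒¬b _ = ⊥-elim (a⇒¬b a b)
∧-disjoint (yes _) (no _)  _    _ = refl
∧-disjoint (no _)  _       _    _ = refl

i<i+1 : ∀ i → i ℤ.< i + 1ℤ
i<i+1 i = ℤ.≤∧≢⇒< (ℤ.i≤i+j i 1ℤ) (λ i≡i+1 → ℤ.i≢suc[i] (trans i≡i+1 (ℤ.+-comm i 1ℤ)))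

i<j+1⇔i<j : ∀ {i j} → i ≢ j → i ℤ.< j + 1ℤ ⇔ i ℤ.< j
i<j+1⇔i<j {i} {j} i≢j =
  mk⇔ (λ i<j+1 → ℤ.≤∧≢⇒< (subst (i ℤ.≤_) pred[j+1]≡j (ℤ.i<j⇒i≤pred[j] i<j+1)) i≢j)
      (λ i<j → ℤ.<-≤-trans i<j (ℤ.i≤i+j j 1ℤ))
  where pred[j+1]≡j : ℤ.pred (j + 1ℤ) ≡ j
        pred[j+1]≡j = trans (sym (ℤ.+-pred j 1ℤ)) (ℤ.+-identityʳ j)

i+k-k≡i : ∀ i k → i + k - k ≡ i
i+k-k≡i = solve-∀

≟-+ʳ : ∀ i j k → ⌊ i + k ℤ.≟ j + k ⌋ ≡ ⌊ i ℤ.≟ j ⌋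
≟-+ʳ i j k = ⌊⌋-⇔ (mk⇔ cancel (cong (_+ k))) (i + k ℤ.≟ j + k) (i ℤ.≟ j)
  where cancel : i + k ≡ j + k → i ≡ j
        cancel i+k≡j+k = trans (sym (i+k-k≡i i k)) (trans (cong (_- k) i+k≡j+k) (i+k-k≡i j k))

≟-+ʳ-suc : ∀ i j k → ⌊ i + k ℤ.≟ j + k + 1ℤ ⌋ ≡ ⌊ i ℤ.≟ j + 1ℤ ⌋
≟-+ʳ-suc i j k = trans (cong (λ m → ⌊ i + k ℤ.≟ m ⌋) (shuffle j k)) (≟-+ʳ i (j + 1ℤ) k)
  where shuffle : ∀ j k → j + k + 1ℤ ≡ j + 1ℤ + k
        shuffle = solve-∀

<?-+ʳ : ∀ i j k → ⌊ i + k ℤ.<? j + k ⌋ ≡ ⌊ i ℤ.<? j ⌋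
<?-+ʳ i j k = ⌊⌋-⇔ (mk⇔ cancel (ℤ.+-monoˡ-< k)) (i + k ℤ.<? j + k) (i ℤ.<? j)
  where cancel : i + k ℤ.< j + k → i ℤ.< j
        cancel lt = subst₂ ℤ._<_ (i+k-k≡i i k) (i+k-k≡i j k) (ℤ.+-monoˡ-< (ℤ.- k) lt)

crosses-sym : ∀ w p q → crosses w (p , q) ≡ crosses w (q , p)
crosses-sym (wa , wb) (pa , pb) (qa , qb) = ∨-comm (⌊ pb ℤ.≟ wb ⌋ ∧ ⌊ qb ℤ.≟ wb + 1ℤ ⌋ ∧ ⌊ wa ℤ.<? pa ⌋) _

crosses-translate : ∀ w p q t → crosses (w ⊕ t) (p ⊕ t , q ⊕ t) ≡ crosses w (p , q)
crosses-translate (wa , wb) (pa , pb) (qa , qb) (ta , tb)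
  rewrite ≟-+ʳ pb wb tb | ≟-+ʳ qb wb tb | ≟-+ʳ-suc pb wb tb | ≟-+ʳ-suc qb wb tb
        | <?-+ʳ wa pa ta | <?-+ʳ wa qa ta = refl

crosses-level : ∀ w a b c → crosses w ((a , c) , (b , c)) ≡ false
crosses-level (wa , wb) a b c =
  cong₂ _∨_ (∧-disjoint (c ℤ.≟ wb) (c ℤ.≟ wb + 1ℤ) rows≢ _) (∧-disjoint (c ℤ.≟ wb) (c ℤ.≟ wb + 1ℤ) rows≢ _)
  where rows≢ : c ≡ wb → c ≢ wb + 1ℤ
        rows≢ refl = ℤ.<⇒≢ (i<i+1 c)

crosses-rising : ∀ w a b c → crosses w ((a , c) , (b , c + 1ℤ)) ≡ ⌊ c ℤ.≟ proj₂ w ⌋ ∧ ⌊ proj₁ w ℤ.<? a ⌋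
crosses-rising (wa , wb) a b c =
  trans (cong₂ _∨_ upwards (∧-disjoint (c + 1ℤ ℤ.≟ wb) (c ℤ.≟ wb + 1ℤ) rows≢ _)) (∨-identityʳ _)
  where
    upwards : ⌊ c ℤ.≟ wb ⌋ ∧ ⌊ c + 1ℤ ℤ.≟ wb + 1ℤ ⌋ ∧ ⌊ wa ℤ.<? a ⌋ ≡ ⌊ c ℤ.≟ wb ⌋ ∧ ⌊ wa ℤ.<? a ⌋
    upwards with c ℤ.≟ wb
    ... | yes refl = cong (_∧ ⌊ wa ℤ.<? a ⌋) (⌊⌋-true (c + 1ℤ ℤ.≟ c + 1ℤ) refl)
    ... | no _     = refl
    rows≢ : c + 1ℤ ≡ wb → c ≢ wb + 1ℤ
    rows≢ refl c≡c+2 = ℤ.<⇒≢ (ℤ.<-trans (i<i+1 c) (i<i+1 (c + 1ℤ))) c≡c+2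

triangleParity : V → V → V → V → Bool
triangleParity w p q r = crosses w (p , q) xor crosses w (q , r) xor crosses w (r , p)

triangleParity-rotate : ∀ w p q r → triangleParity w p q r ≡ triangleParity w q r p
triangleParity-rotate w p q r = trans (xor-comm (crosses w (p , q)) _) (xor-assoc (crosses w (q , r)) _ _)

triangleParity-swap : ∀ w p q r → triangleParity w p q r ≡ triangleParity w p r q
triangleParity-swap w p q r
  rewrite crosses-sym w p r | crosses-sym w r q | crosses-sym w q p = begin
    a xor b xor c   ≡⟨ xor-comm a _ ⟩
    (b xor c) xor a ≡⟨ cong (_xor a) (xor-comm b c) ⟩
    (c xor b) xor a ≡⟨ xor-assoc c b a ⟩
    c xor b xor a   ∎
  where
    open ≡-Reasoning
    a = crosses w (p , q)
    b = crosses w (q , r)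
    c = crosses w (r , p)

triangleParity-translate : ∀ w p q r t →
  triangleParity (w ⊕ t) (p ⊕ t) (q ⊕ t) (r ⊕ t) ≡ triangleParity w p q r
triangleParity-translate w p q r t
  rewrite crosses-translate w p q t | crosses-translate w q r t | crosses-translate w r p t = refl

-- The two slanted sides of the upward triangle rise from (x , y) and
-- (x + 1 , y), and the ray separates these two points only when it starts
-- at (x , y); both slanted sides of the downward triangle rise from (x + 1 , y).
up-parity : ∀ w x y → w ≢ (x , y) → triangleParity w (x , y) (x + 1ℤ , y) (x , y + 1ℤ) ≡ false
up-parity (wa , wb) x y w≢xy
  rewrite crosses-level (wa , wb) x (x + 1ℤ) y | crosses-rising (wa , wb) (x + 1ℤ) x y
        | crosses-sym (wa , wb) (x , y + 1ℤ) (x , y) | crosses-rising (wa , wb) x x y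
  with y ℤ.≟ wb
... | no _     = refl
... | yes refl = trans (cong (_xor ⌊ wa ℤ.<? x ⌋) (⌊⌋-⇔ (i<j+1⇔i<j wa≢x) (wa ℤ.<? x + 1ℤ) (wa ℤ.<? x)))
                       (xor-same ⌊ wa ℤ.<? x ⌋)
  where wa≢x : wa ≢ x
        wa≢x wa≡x = w≢xy (cong (_, y) wa≡x)

down-parity : ∀ w x y → triangleParity w (x + 1ℤ , y) (x , y + 1ℤ) (x + 1ℤ , y + 1ℤ) ≡ false
down-parity w x y
  rewrite crosses-rising w (x + 1ℤ) x y | crosses-level w x (x + 1ℤ) (y + 1ℤ)
        | crosses-sym w (x + 1ℤ , y + 1ℤ) (x + 1ℤ , y) | crosses-rising w (x + 1ℤ) (x + 1ℤ) y
  = xor-same (⌊ y ℤ.≟ proj₂ w ⌋ ∧ ⌊ proj₁ w ℤ.<? x + 1ℤ ⌋)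

fan-parity : ∀ k w → w ≢ origin → w ≢ offset k → w ≢ offset (next k) →
             triangleParity w origin (offset k) (offset (next k)) ≡ false
fan-parity zero w w≢o _ _ = up-parity w 0ℤ 0ℤ w≢o
fan-parity (suc zero) w _ _ _ =
  trans (triangleParity-swap w origin _ _) (trans (triangleParity-rotate w origin _ _) (down-parity w -1ℤ -1ℤ))
fan-parity (suc (suc zero)) w _ _ _ = trans (triangleParity-swap w origin _ _) (down-parity w -1ℤ 0ℤ)
fan-parity (suc (suc (suc zero))) w _ w≢k _ =
  trans (triangleParity-rotate w origin _ _) (up-parity w 0ℤ -1ℤ w≢k)
fan-parity (suc (suc (suc (suc zero)))) w _ _ _ =
  trans (triangleParity-rotate w origin (1ℤ , -1ℤ) (1ℤ , 0ℤ))
        (trans (triangleParity-swap w (1ℤ , -1ℤ) (1ℤ , 0ℤ) origin) (down-parity w 0ℤ -1ℤ))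
fan-parity (suc (suc (suc (suc (suc zero))))) w _ _ w≢next =
  trans (sym (triangleParity-rotate w _ origin _)) (up-parity w -1ℤ 0ℤ w≢next)

unitTriangle-parity : ∀ {w u p q} → Adj u p → Adj u q → Adj p q → w ≢ u → w ≢ p → w ≢ q →
                      triangleParity w u p q ≡ false
unitTriangle-parity {w} {u} {p} {q} u~p u~q p~q w≢u w≢p w≢q
  with Adj⇒offset {u} {p} u~p | Adj⇒offset {u} {q} u~q
... | k , refl | l , refl = begin
  triangleParity w u (offset k ⊕ u) (offset l ⊕ u)
    ≡⟨ cong₂ (λ w′ u′ → triangleParity w′ u′ (offset k ⊕ u) (offset l ⊕ u)) (sym (⊖-⊕ w u)) (sym (⊕-identityˡ u)) ⟩
  triangleParity (w ⊖ u ⊕ u) (origin ⊕ u) (offset k ⊕ u) (offset l ⊕ u)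
    ≡⟨ triangleParity-translate (w ⊖ u) origin (offset k) (offset l) u ⟩
  triangleParity (w ⊖ u) origin (offset k) (offset l)
    ≡⟨ centred (offsets-adjacent k l (Adj-translate {offset k} {offset l} u p~q)) ⟩
  false ∎
  where
    open ≡-Reasoning
    w⊖u≢o : w ⊖ u ≢ origin
    w⊖u≢o w⊖u≡o = w≢u (trans (⊖⇒⊕ w⊖u≡o) (⊕-identityˡ u))
    centred : l ≡ next k ⊎ k ≡ next l → triangleParity (w ⊖ u) origin (offset k) (offset l) ≡ false
    centred (inj₁ refl) = fan-parity k (w ⊖ u) w⊖u≢o (w≢p ∘ ⊖⇒⊕) (w≢q ∘ ⊖⇒⊕)
    centred (inj₂ refl) = trans (triangleParity-swap (w ⊖ u) origin _ _)
                                (fan-parity l (w ⊖ u) w⊖u≢o (w≢q ∘ ⊖⇒⊕) (w≢p ∘ ⊖⇒⊕))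

walkParity : V → List V → Bool
walkParity w []           = false
walkParity w (_ ∷ [])     = false
walkParity w (x ∷ y ∷ ys) = crosses w (x , y) xor walkParity w (y ∷ ys)

closedWalk : List V → List V
closedWalk []       = []
closedWalk (x ∷ xs) = x ∷ xs ++ [ x ]

cycleEdges-parity : ∀ w C → foldr (λ e acc → crosses w e xor acc) false (cycleEdges C) ≡ walkParity w (closedWalk C)
cycleEdges-parity w [] = refl
cycleEdges-parity w (x ∷ xs) = go x xs
  where go : ∀ y ys → foldr (λ e acc → crosses w e xor acc) false (zip (y ∷ ys) (ys ++ [ x ]))
                     ≡ walkParity w (y ∷ ys ++ [ x ])
        go y []       = refl
        go y (z ∷ zs) = cong (crosses w (y , z) xor_) (go z zs)

walkParity-++ : ∀ w X y Y → walkParity w (X ++ y ∷ Y) ≡ walkParity w (X ++ [ y ]) xor walkParity w (y ∷ Y)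
walkParity-++ w [] y Y = refl
walkParity-++ w (x ∷ []) y Y = cong (_xor walkParity w (y ∷ Y)) (sym (xor-identityʳ (crosses w (x , y))))
walkParity-++ w (x ∷ x′ ∷ X) y Y =
  trans (cong (crosses w (x , x′) xor_) (walkParity-++ w (x′ ∷ X) y Y)) (sym (xor-assoc (crosses w (x , x′)) _ _))

walkParity-excise : ∀ w P y B Q →
  walkParity w (P ++ y ∷ B ++ y ∷ Q) ≡ walkParity w (closedWalk (y ∷ B)) xor walkParity w (P ++ y ∷ Q)
walkParity-excise w P y B Q = begin
  walkParity w (P ++ y ∷ B ++ y ∷ Q)  ≡⟨ walkParity-++ w P y (B ++ y ∷ Q) ⟩
  p xor walkParity w (y ∷ B ++ y ∷ Q) ≡⟨ cong (p xor_) (walkParity-++ w (y ∷ B) y Q) ⟩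
  p xor b xor q                       ≡⟨ xor-assoc p b q ⟨
  (p xor b) xor q                     ≡⟨ cong (_xor q) (xor-comm p b) ⟩
  (b xor p) xor q                     ≡⟨ xor-assoc b p q ⟩
  b xor p xor q                       ≡⟨ cong (b xor_) (walkParity-++ w P y Q) ⟨
  b xor walkParity w (P ++ y ∷ Q)     ∎
  where
    open ≡-Reasoning
    p = walkParity w (P ++ [ y ])
    b = walkParity w (closedWalk (y ∷ B))
    q = walkParity w (y ∷ Q)

module _ {R : V → V → Set} where

  Linked-++⁻ : ∀ X y Y → Linked R (X ++ y ∷ Y) → Linked R (X ++ [ y ]) × Linked R (y ∷ Y)
  Linked-++⁻ []           y Y linked       = [-] , linked
  Linked-++⁻ (x ∷ [])     y Y (r ∷ linked) = r ∷ [-] , linked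
  Linked-++⁻ (x ∷ x′ ∷ X) y Y (r ∷ linked) = map₁ (r ∷_) (Linked-++⁻ (x′ ∷ X) y Y linked)

  Linked-++⁺ : ∀ X y Y → Linked R (X ++ [ y ]) → Linked R (y ∷ Y) → Linked R (X ++ y ∷ Y)
  Linked-++⁺ []           y Y _           linked = linked
  Linked-++⁺ (x ∷ [])     y Y (r ∷ _)     linked = r ∷ linked
  Linked-++⁺ (x ∷ x′ ∷ X) y Y (r ∷ linked′) linked = r ∷ Linked-++⁺ (x′ ∷ X) y Y linked′ linked

  Linked-excise : ∀ P y B Q → Linked R (P ++ y ∷ B ++ y ∷ Q) →
                  Linked R (closedWalk (y ∷ B)) × Linked R (P ++ y ∷ Q)
  Linked-excise P y B Q linked =
    let (linkedP , linkedRest) = Linked-++⁻ P y (B ++ y ∷ Q) linked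
        (linkedB , linkedQ)    = Linked-++⁻ (y ∷ B) y Q linkedRest
    in linkedB , Linked-++⁺ P y Q linkedP linkedQ

closedWalk-excise-shape : ∀ A y B D → ∃[ P ] ∃[ Q ]
  closedWalk (A ++ y ∷ B ++ y ∷ D) ≡ P ++ y ∷ B ++ y ∷ Q × closedWalk (A ++ y ∷ D) ≡ P ++ y ∷ Q
closedWalk-excise-shape [] y B D = [] , D ++ [ y ] , cong (y ∷_) (++-assoc B (y ∷ D) [ y ]) , refl
closedWalk-excise-shape (a ∷ A) y B D =
  a ∷ A , D ++ [ a ] ,
  cong (a ∷_) (trans (++-assoc A (y ∷ B ++ y ∷ D) [ a ]) (cong (λ L → A ++ y ∷ L) (++-assoc B (y ∷ D) [ a ]))) ,
  cong (a ∷_) (++-assoc A (y ∷ D) [ a ])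

closedWalk-excise-Linked : ∀ {R} A y B D → Linked R (closedWalk (A ++ y ∷ B ++ y ∷ D)) →
  Linked R (closedWalk (y ∷ B)) × Linked R (closedWalk (A ++ y ∷ D))
closedWalk-excise-Linked {R} A y B D linked with closedWalk-excise-shape A y B D
... | P , Q , whole≡ , outer≡ =
  map₂ (subst (Linked R) (sym outer≡)) (Linked-excise P y B Q (subst (Linked R) whole≡ linked))

closedWalk-excise-parity : ∀ w A y B D → walkParity w (closedWalk (A ++ y ∷ B ++ y ∷ D))
  ≡ walkParity w (closedWalk (y ∷ B)) xor walkParity w (closedWalk (A ++ y ∷ D))
closedWalk-excise-parity w A y B D with closedWalk-excise-shape A y B D
... | P , Q , whole≡ , outer≡ rewrite whole≡ | outer≡ = walkParity-excise w P y B Q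

¬Unique⇒duplicate : ∀ (xs : List V) → ¬ Unique xs → ∃[ A ] ∃[ y ] ∃[ B ] ∃[ D ] xs ≡ A ++ y ∷ B ++ y ∷ D
¬Unique⇒duplicate [] ¬unique = ⊥-elim (¬unique [])
¬Unique⇒duplicate (x ∷ xs) ¬unique with x ∈? xs
... | yes x∈xs = let (B , D , xs≡) = ∈-∃++ x∈xs in [] , x , B , D , cong (x ∷_) xs≡
... | no x∉xs =
  let (A , y , B , D , xs≡) = ¬Unique⇒duplicate xs (¬unique ∘ (All.¬Any⇒All¬ xs x∉xs ∷_))
  in x ∷ A , y , B , D , cong (x ∷_) xs≡

length-<-∷++ : ∀ B (y : V) D → length D ℕ.< length (B ++ y ∷ D)
length-<-∷++ []      y D = ℕ.n<1+n (length D)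
length-<-∷++ (_ ∷ B) y D = ℕ.m<n⇒m<1+n (length-<-∷++ B y D)

length-<-++∷ : ∀ B (y : V) D → length B ℕ.< length (B ++ y ∷ D)
length-<-++∷ []      y D = s≤s z≤n
length-<-++∷ (_ ∷ B) y D = s≤s (length-<-++∷ B y D)

length-loop-< : ∀ A (y : V) B D → length (y ∷ B) ℕ.< length (A ++ y ∷ B ++ y ∷ D)
length-loop-< []      y B D = s≤s (length-<-++∷ B y D)
length-loop-< (_ ∷ A) y B D = ℕ.m<n⇒m<1+n (length-loop-< A y B D)

length-excise-< : ∀ A (y : V) B D → length (A ++ y ∷ D) ℕ.< length (A ++ y ∷ B ++ y ∷ D)
length-excise-< []      y B D = s≤s (length-<-∷++ B y D)
length-excise-< (_ ∷ A) y B D = s≤s (length-excise-< A y B D)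

xor≡true⇒⊎ : ∀ a b → a xor b ≡ true → a ≡ true ⊎ b ≡ true
xor≡true⇒⊎ true  _ _         = inj₁ refl
xor≡true⇒⊎ false _ b≡true    = inj₂ b≡true

EnclosingSubcycle : V → List V → Set
EnclosingSubcycle w C = ∃[ C′ ] IsCycle C′ × C′ ⊆ C × Encloses C′ w

EnclosingSubcycle-mono : ∀ {w C₁ C₂} → C₁ ⊆ C₂ → EnclosingSubcycle w C₁ → EnclosingSubcycle w C₂
EnclosingSubcycle-mono C₁⊆C₂ (C′ , cycle , C′⊆C₁ , encloses) = C′ , cycle , ⊆-trans C′⊆C₁ C₁⊆C₂ , encloses

module _ (w : V) where

  uniqueOddClosedWalk⇒IsCycle : ∀ C → Unique C → Linked Adj (closedWalk C) →
                                walkParity w (closedWalk C) ≡ true → IsCycle C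
  uniqueOddClosedWalk⇒IsCycle (x ∷ []) _ (x~x ∷ _) _ = ⊥-elim (Adj-irrefl {x} x~x)
  uniqueOddClosedWalk⇒IsCycle (x ∷ y ∷ []) _ _ odd
    rewrite crosses-sym w x y | xor-identityʳ (crosses w (y , x)) | xor-same (crosses w (y , x))
    with () ← odd
  uniqueOddClosedWalk⇒IsCycle (x ∷ y ∷ z ∷ zs) unique closed _ = s≤s (s≤s z≤n) , unique , closed

  oddClosedWalk⇒enclosingSubcycle : ∀ C → Linked Adj (closedWalk C) → walkParity w (closedWalk C) ≡ true →
                                    EnclosingSubcycle w C
  oddClosedWalk⇒enclosingSubcycle C = go C (<-wellFounded (length C))
    where
    go : ∀ C → Acc ℕ._<_ (length C) → Linked Adj (closedWalk C) → walkParity w (closedWalk C) ≡ true →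
         EnclosingSubcycle w C
    go C _ closed odd with unique? C
    ... | yes unique = C , uniqueOddClosedWalk⇒IsCycle C unique closed odd , ⊆-refl ,
                       trans (cycleEdges-parity w C) odd
    ... | no ¬unique with ¬Unique⇒duplicate C ¬unique
    go _ (acc shorter) closed odd | no _ | A , y , B , D , refl
      with closedWalk-excise-Linked A y B D closed
         | xor≡true⇒⊎ _ _ (trans (sym (closedWalk-excise-parity w A y B D)) odd)
    ... | loopClosed , _ | inj₁ loopOdd =
      EnclosingSubcycle-mono (xs⊆ys++xs (y ∷ B ++ y ∷ D) A ∘ xs⊆xs++ys (y ∷ B) (y ∷ D))
        (go (y ∷ B) (shorter (length-loop-< A y B D)) loopClosed loopOdd)
    ... | _ , outerClosed | inj₂ outerOdd =
      EnclosingSubcycle-mono (++⁺ʳ A (xs⊆ys++xs (y ∷ D) (y ∷ B)))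
        (go (A ++ y ∷ D) (shorter (length-excise-< A y B D)) outerClosed outerOdd)

module _ {P : VSet} where

  Path-start : ∀ {a b} → Path P a b → P a
  Path-start (here pa)     = pa
  Path-start (step pa _ _) = pa

  Path-++ : ∀ {a b c} → Path P a b → Path P b c → Path P a c
  Path-++ (here _)         q = q
  Path-++ (step pa a~u p) q = step pa a~u (Path-++ p q)

  pathVertices : ∀ {a b} → Path P a b → List V
  pathVertices (here _)         = []
  pathVertices (step {a} _ _ p) = a ∷ pathVertices p

  pathParity : V → ∀ {a b} → Path P a b → Bool
  pathParity w (here _)             = false
  pathParity w (step {a} {u} _ _ p) = crosses w (a , u) xor pathParity w p

  pathParity-++ : ∀ w {a b c} (p : Path P a b) (q : Path P b c) →
                  pathParity w (Path-++ p q) ≡ pathParity w p xor pathParity w q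
  pathParity-++ w (here _) q = refl
  pathParity-++ w (step {a} {u} _ _ p) q =
    trans (cong (crosses w (a , u) xor_) (pathParity-++ w p q)) (sym (xor-assoc (crosses w (a , u)) _ _))

  Path⇒walk : ∀ w {a b} (p : Path P a b) →
    Linked Adj (pathVertices p ++ [ b ]) × All P (pathVertices p ++ [ b ]) ×
    walkParity w (pathVertices p ++ [ b ]) ≡ pathParity w p
  Path⇒walk w (here pb) = [-] , pb ∷ [] , refl
  Path⇒walk w (step pa a~u (here pu)) = a~u ∷ [-] , pa ∷ pu ∷ [] , refl
  Path⇒walk w (step {a} {u} pa a~u p@(step _ _ _)) =
    let (linked , inP , parity) = Path⇒walk w p
    in a~u ∷ linked , pa ∷ inP , cong (crosses w (a , u) xor_) parity

  walk⇒Path : ∀ w x xs y → Linked Adj (x ∷ xs ++ [ y ]) → All P (x ∷ xs ++ [ y ]) →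
    Σ (Path P x y) λ p → pathParity w p ≡ walkParity w (x ∷ xs ++ [ y ])
  walk⇒Path w x [] y (x~y ∷ [-]) (px ∷ py ∷ []) = step px x~y (here py) , refl
  walk⇒Path w x (u ∷ xs) y (x~u ∷ linked) (px ∷ inP) =
    let (p , parity) = walk⇒Path w u xs y linked inP
    in step px x~u p , cong (crosses w (x , u) xor_) parity

  oddClosedPath⇒enclosingCycle : ∀ w {x} (p : Path P x x) → pathParity w p ≡ true →
    ∃[ C ] IsCycle C × All P C × Encloses C w
  oddClosedPath⇒enclosingCycle w (here _) ()
  oddClosedPath⇒enclosingCycle w p@(step _ _ _) odd =
    let (closed , inP , parity) = Path⇒walk w p
        (C , cycle , C⊆ , encloses) = oddClosedWalk⇒enclosingSubcycle w (pathVertices p) closed (trans parity odd)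
    in C , cycle , All.anti-mono C⊆ (All.++⁻ˡ (pathVertices p) inP) , encloses

Path-map : ∀ {P Q : VSet} → (∀ {u} → P u → Q u) → ∀ {a b} → Path P a b → Path Q a b
Path-map f (here pa)         = here (f pa)
Path-map f (step pa a~u p) = step (f pa) a~u (Path-map f p)

pathParity-map : ∀ {P Q : VSet} (f : ∀ {u} → P u → Q u) w {a b} (p : Path P a b) →
                 pathParity w (Path-map f p) ≡ pathParity w p
pathParity-map f w (here _)             = refl
pathParity-map f w (step {a} {u} _ _ p) = cong (crosses w (a , u) xor_) (pathParity-map f w p)

Neighbours : VSet → V → VSet
Neighbours S v u = Adj v u × S u

xor≡false⇒≡ : ∀ a b → a xor b ≡ false → a ≡ b
xor≡false⇒≡ true  true  _ = refl
xor≡false⇒≡ false false _ = refl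

module _ {S : VSet} {v w : V} (w∉S : ¬ S w) (w≢v : w ≢ v) where

  detour-parity : ∀ {a b} (p : Path (Neighbours S v) a b) →
                  pathParity w p ≡ crosses w (a , v) xor crosses w (v , b)
  detour-parity {a} (here _) =
    sym (trans (cong (crosses w (a , v) xor_) (crosses-sym w v a)) (xor-same (crosses w (a , v))))
  detour-parity {a} {b} (step {w = u} (v~a , Sa) a~u p) = begin
    crosses w (a , u) xor pathParity w p                            ≡⟨ cong (crosses w (a , u) xor_) (detour-parity p) ⟩
    crosses w (a , u) xor crosses w (u , v) xor crosses w (v , b)   ≡⟨ xor-assoc (crosses w (a , u)) _ _ ⟨
    (crosses w (a , u) xor crosses w (u , v)) xor crosses w (v , b) ≡⟨ cong (_xor crosses w (v , b)) around-triangle ⟩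
    crosses w (a , v) xor crosses w (v , b)                         ∎
    where
      open ≡-Reasoning
      v~u = proj₁ (Path-start p)
      Su  = proj₂ (Path-start p)
      around-triangle : crosses w (a , u) xor crosses w (u , v) ≡ crosses w (a , v)
      around-triangle =
        trans (sym (xor≡false⇒≡ (crosses w (v , a)) _
                 (unitTriangle-parity {w} {v} {a} {u} v~a v~u a~u w≢v (λ { refl → w∉S Sa }) (λ { refl → w∉S Su }))))
              (crosses-sym w v a)

module _ {S : VSet} {v : V} (neighbours-connected : Connected (Neighbours S v))
         {w : V} (w∉S : ¬ S w) (w≢v : w ≢ v) where

  bypass : ∀ {a b} → S a → S b → (p : Path (AddVertex S v) a b) →
           Σ (Path S a b) λ q → pathParity w q ≡ pathParity w p
  bypass Sa Sb (here _) = here Sa , refl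
  bypass Sa Sb (step {u = a} {w = u} _ a~u p) with Path-start p
  ... | inj₁ Su = let (q , parity) = bypass Su Sb p in step Sa a~u q , cong (crosses w (a , u) xor_) parity
  bypass Sa Sb (step _ a~v (here _)) | inj₂ refl = step Sa a~v (here Sb) , refl
  bypass Sa Sb (step {u = a} _ a~v (step {w = z} _ v~z p)) | inj₂ refl with Path-start p
  ... | inj₂ refl = ⊥-elim (Adj-irrefl {v} v~z)
  ... | inj₁ Sz = Path-++ d q , parity
    where
      open ≡-Reasoning
      n = neighbours-connected (Adj-sym {a} {v} a~v , Sa) (v~z , Sz)
      d = Path-map proj₂ n
      bypassed = bypass Sz Sb p
      q = proj₁ bypassed
      parity : pathParity w (Path-++ d q) ≡ crosses w (a , v) xor crosses w (v , z) xor pathParity w p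
      parity = begin
        pathParity w (Path-++ d q)                                   ≡⟨ pathParity-++ w d q ⟩
        pathParity w d xor pathParity w q                            ≡⟨ cong₂ _xor_
                                                                          (trans (pathParity-map proj₂ w n) (detour-parity w∉S w≢v n))
                                                                          (proj₂ bypassed) ⟩
        (crosses w (a , v) xor crosses w (v , z)) xor pathParity w p ≡⟨ xor-assoc (crosses w (a , v)) _ _ ⟩
        crosses w (a , v) xor crosses w (v , z) xor pathParity w p   ∎

closedPath-rebase : ∀ {S : VSet} {v} w {x} (p : Path (AddVertex S v) x x) → pathParity w p ≡ true →
  ∃[ y ] S y × Σ (Path (AddVertex S v) y y) λ q → pathParity w q ≡ true
closedPath-rebase w p odd with Path-start p
... | inj₁ Sx = _ , Sx , p , odd
closedPath-rebase w (here _) () | inj₂ refl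
closedPath-rebase {v = v} w (step {w = c} _ v~c p) odd | inj₂ refl with Path-start p
... | inj₂ refl = ⊥-elim (Adj-irrefl {v} v~c)
... | inj₁ Sc = c , Sc , Path-++ p (step (inj₂ refl) v~c (here (inj₁ Sc))) , rotated-odd
  where
    rotated-odd : pathParity w (Path-++ p (step (inj₂ refl) v~c (here (inj₁ Sc)))) ≡ true
    rotated-odd = trans (pathParity-++ w p _)
      (trans (cong (pathParity w p xor_) (xor-identityʳ (crosses w (v , c)))) (trans (xor-comm (pathParity w p) _) odd))

addVertex-connected : ∀ {S v} → Connected S → ∃ (Neighbours S v) → Connected (AddVertex S v)
addVertex-connected connected (u , v~u , Su) (inj₁ Sx) (inj₁ Sy) = Path-map inj₁ (connected Sx Sy)
addVertex-connected {v = v} connected (u , v~u , Su) (inj₁ Sx) (inj₂ refl) =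
  Path-++ (Path-map inj₁ (connected Sx Su)) (step (inj₁ Su) (Adj-sym {v} {u} v~u) (here (inj₂ refl)))
addVertex-connected connected (u , v~u , Su) (inj₂ refl) (inj₁ Sy) =
  step (inj₂ refl) v~u (Path-map inj₁ (connected Su Sy))
addVertex-connected connected _ (inj₂ refl) (inj₂ refl) = here (inj₂ refl)

addVertex-simplyConnected : ∀ {S v} → SimplyConnected S → ∃ (Neighbours S v) → Connected (Neighbours S v) →
                            SimplyConnected (AddVertex S v)
addVertex-simplyConnected {S} {v} (connected , holeFree) nonempty neighbours-connected =
  addVertex-connected connected nonempty , holeFree′
  where
  holeFree′ : ∀ C → IsCycle C → All (AddVertex S v) C → ∀ w → ¬ AddVertex S v w → ¬ Encloses C w
  holeFree′ C@(x ∷ xs) (_ , _ , closed) inC w w∉ encloses =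
    let (p , parity)                  = walk⇒Path w x xs x closed (All.++⁺ inC (All.head inC ∷ []))
        (y , Sy , q , q-odd)          = closedPath-rebase w p (trans parity (trans (sym (cycleEdges-parity w C)) encloses))
        (q′ , parity′)                = bypass neighbours-connected (w∉ ∘ inj₁) (w∉ ∘ inj₂) Sy Sy q
        (C′ , cycle , inS , encloses′) = oddClosedPath⇒enclosingCycle w q′ (trans parity′ q-odd)
    in holeFree C′ cycle inS w (w∉ ∘ inj₁) encloses′

lemma3 : (T : Triangle) (lab : V → Fin 3) → IsPartition T lab →
    (i : Fin 3) (v : V) → InT T v → ¬ (lab v ≡ i) →
    ∃ (Nbhd T lab i v) → Connected (Nbhd T lab i v) →
    SimplyConnected (AddVertex (District T lab i) v)
lemma3 T lab partition i v _ _ = addVertex-simplyConnected (proj₂ (partition i))
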